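{- Fix the constants $\tfrac12<\tau_a<\tau_b<1$ and let $\tau_{m_1}:=\tau_a+\frac15(\tau_b-\tau_a)$, $\tau_{m_2}:=\tau_b-\frac15(\tau_b-\tau_a)$. Consider a sequence of query vectors $\boldsymbol{v}_1,\boldsymbol{v}_2,\dots\in\mathbb{R}^n$ and the stable estimator, which maintains a reported set $\texttt{K}$ (initially empty) and, upon each query $\boldsymbol{v}$, lets a key $i\notin\texttt{K}$ enter $\texttt{K}$ when $\max\{\hat p^+(\boldsymbol{v},i),\hat p^-(\boldsymbol{v},i)\}\ge\tau_{m_2}$, and lets a key $i\in\texttt{K}$ exit $\texttt{K}$ when $\max\{\hat p^+(\boldsymbol{v},i),\hat p^-(\boldsymbol{v},i)\}<\tau_{m_1}$. Suppose that for all queries $\boldsymbol{v}$, all keys $i\in[n]$ and $\sigma\in\{+,-\}$, $|\hat p^\sigma(\boldsymbol{v},i)-p^\sigma(\boldsymbol{v},i)|\le\frac15(\tau_b-\tau_a)$. Then after each query $\boldsymbol{v}$, $\mathrm{heavy}(\boldsymbol{v})\subseteq\texttt{K}\subseteq\mathrm{suspect}(\boldsymbol{v})$. Moreover, the reporting status of a key $i$ can change only when $p(\boldsymbol{v},i)$ changes by at least $\frac15(\tau_b-\tau_a)$ (between the query at which its status last changed and the query at which it changes again).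
   Context: The bucket distribution $\mathcal{B}$ for width $b$: $\boldsymbol{\mu}\in\{ -1,0,1\}^n$ with $\mu[i]=h(i)s(i)$, $h:[n]\to\{0,1\}$ $3$-wise independent with $\Pr[h(i)=1]=1/b$, $s:[n]\to\{\pm1\}$ independent, $5$-wise independent, uniform. $p^+(\boldsymbol{v},i):=\Pr_{\boldsymbol{\mu}\sim\mathcal{B}}[\langle\boldsymbol{\mu},\boldsymbol{v}\rangle\mu[i]>0\mid\mu[i]\ne0]$, $p^-(\boldsymbol{v},i):=\Pr_{\boldsymbol{\mu}\sim\mathcal{B}}[\langle\boldsymbol{\mu},\boldsymbol{v}\rangle\mu[i]<0\mid\mu[i]\ne0]$, $p:=\max\{p^+,p^-\}$. The constants $\tfrac12<\tau_a<\tau_b<1$ (together with constants $C_a,C_b>0$) are such that for all $n,b,\boldsymbol{v},i$: $v[i]^2>\frac{C_b^2}{b}\|\boldsymbol{v}_{\mathsf{tail}[b/C_b^2]}\|_2^2$ implies $p(\boldsymbol{v},i)\ge\tau_b$, and $v[i]^2\le\frac1b\|\boldsymbol{v}_{\mathsf{tail}[C_ab]}\|_2^2$ implies $p(\boldsymbol{v},i)\le\tau_a$ ($\boldsymbol{v}_{\mathsf{tail}[k]}$ is $\boldsymbol{v}$ with its $k$ largest-magnitude entries zeroed). $\mathrm{heavy}(\boldsymbol{v}):=\{i:p(\boldsymbol{v},i)\ge\tau_b\}$, $\mathrm{suspect}(\boldsymbol{v}):=\{i:p(\boldsymbol{v},i)\ge\tau_a\}$.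
   Formalization: The constants τ_a and τ_b are rational, and the probabilities p^σ and the estimates p̂^σ take values in ℚ. -}

module Defs where

open import Data.Nat using (ℕ; zero; suc)
open import Data.Integer using (+_)
open import Data.Fin using (Fin)
open import Data.Bool using (Bool; true; false; if_then_else_)
open import Data.Rational using (ℚ; _/_; _-_; _+_; _*_; _⊔_; _≤_; _<_)
open import Data.Rational.Properties using (_≤?_; _<?_)
open import Relation.Nullary.Decidable using (⌊_⌋)

data Sign : Set where
  plus minus : Sign

fifth : ℚ
fifth = (+ 1) / 5

gap : ℚ → ℚ → ℚ
gap τa τb = (τb - τa) * fifth

τm₁ : ℚ → ℚ → ℚ
τm₁ τa τb = τa + gap τa τb

τm₂ : ℚ → ℚ → ℚ
τm₂ τa τb = τb - gap τa τb

pmax : {Q : Set} {n : ℕ} → (Sign → Q → Fin n → ℚ) → Q → Fin n → ℚ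
pmax p v i = p plus v i ⊔ p minus v i

heavy : {Q : Set} {n : ℕ} → ℚ → (Sign → Q → Fin n → ℚ) → Q → Fin n → Set
heavy τb p v i = τb ≤ pmax p v i

suspect : {Q : Set} {n : ℕ} → ℚ → (Sign → Q → Fin n → ℚ) → Q → Fin n → Set
suspect τa p v i = τa ≤ pmax p v i

-- The stable estimator. `phat t σ i` is the estimate p̂^σ(v_t, i) used when
-- processing the t-th query (queries indexed from 0).
-- `inK τa τb phat t i` : is key i in K after the first t queries
-- (t = 0: before any query, K empty).
inK : {n : ℕ} → ℚ → ℚ → (ℕ → Sign → Fin n → ℚ) → ℕ → Fin n → Bool
inK τa τb phat zero i = false
inK τa τb phat (suc t) i =
  if inK τa τb phat t i
  then (if ⌊ (phat t plus i ⊔ phat t minus i) <? τm₁ τa τb ⌋ then false else true)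
  else ⌊ τm₂ τa τb ≤? (phat t plus i ⊔ phat t minus i) ⌋

{-# OPTIONS --safe #-}
-- Since max is 1-Lipschitz, the estimate max(p̂⁺, p̂⁻) is within δ = (τb − τa)/5 of p.
-- The estimator is a hysteresis on this estimate with thresholds τm₁ = τa + δ ≤ τm₂ = τb − δ:
-- a key with p ≥ τb has estimate ≥ τm₂ and is reported, and a reported key has estimate
-- ≥ τm₁, hence p ≥ τa. Consecutive status changes of a key alternate between an entry
-- (estimate ≥ τm₂, so p ≥ τb − 2δ) and an exit (estimate < τm₁, so p < τa + 2δ), and
-- τb − 2δ = (τa + 2δ) + δ.
module Submission where

open import Defs
open import Data.Nat using (ℕ; suc) renaming (_<_ to _<ℕ_)
open import Data.Fin using (Fin)
open import Data.Bool using (Bool; true)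
open import Data.Product using (_×_)
open import Data.Rational using (ℚ; ½; 1ℚ; _-_; ∣_∣; _≤_; _<_)
open import Relation.Binary.PropositionalEquality using (_≡_; _≢_)

open import Data.Bool using (false; not; if_then_else_)
open import Data.Nat using (s≤s)
open import Data.Bool.Properties using (¬-not)
open import Data.Integer using (+_; -[1+_])
open import Data.Nat.Properties using (m≤n⇒m<n∨m≡n; m<n⇒m<1+n) renaming (≤-refl to ≤ℕ-refl)
open import Data.Product using (_,_)
open import Data.Rational using (mkℚ; 0ℚ; _+_; -_; _⊔_)
open import Data.Rational.Properties
open import Data.Rational.Solver using (module +-*-Solver)
open import Data.Sum using (_⊎_; inj₁; inj₂)
open import Relation.Binary.PropositionalEquality using (refl; sym; trans; cong; subst)
open import Relation.Nullary using (yes; no; contradiction)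
open import Relation.Nullary.Decidable using (⌊_⌋)

open +-*-Solver using (solve; _:=_; _:+_; _:-_; _:*_; :-_; con)

private
  variable
    A : Set
    s t : ℕ
    p q r p₁ p₂ q₁ q₂ lo hi ε x : ℚ

p≡q+[p-q] : ∀ p q → p ≡ q + (p - q)
p≡q+[p-q] = solve 2 (λ p q → p := q :+ (p :- q)) refl

[p+q]-p≡q : ∀ p q → (p + q) - p ≡ q
[p+q]-p≡q = solve 2 (λ p q → (p :+ q) :- p := q) refl

[p+q]-q≡p : ∀ p q → (p + q) - q ≡ p
[p+q]-q≡p = solve 2 (λ p q → (p :+ q) :- q := p) refl

-[p-q]≡q-p : ∀ p q → - (p - q) ≡ q - p
-[p-q]≡q-p = solve 2 (λ p q → :- (p :- q) := q :- p) refl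

p≤∣p∣ : ∀ p → p ≤ ∣ p ∣
p≤∣p∣ (mkℚ (+ _) _ _) = ≤-refl
p≤∣p∣ p@(mkℚ -[1+ _ ] _ _) = <⇒≤ (neg<pos p ∣ p ∣)

∣p-q∣≡∣q-p∣ : ∀ p q → ∣ p - q ∣ ≡ ∣ q - p ∣
∣p-q∣≡∣q-p∣ p q = trans (sym (∣-p∣≡∣p∣ (p - q))) (cong ∣_∣ (-[p-q]≡q-p p q))

p≤p+q : 0ℚ ≤ q → p ≤ p + q
p≤p+q {q = q} {p = p} 0≤q = subst (_≤ p + q) (+-identityʳ p) (+-monoʳ-≤ p 0≤q)

p≤q+r⇒p-q≤r : p ≤ q + r → p - q ≤ r
p≤q+r⇒p-q≤r {p} {q} {r} p≤q+r = subst (p - q ≤_) ([p+q]-p≡q q r) (+-monoˡ-≤ (- q) p≤q+r)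

p≤q+r⇒p-r≤q : p ≤ q + r → p - r ≤ q
p≤q+r⇒p-r≤q {p} {q} {r} p≤q+r = p≤q+r⇒p-q≤r (subst (p ≤_) (+-comm q r) p≤q+r)

p+r≤q⇒r≤∣q-p∣ : p + r ≤ q → r ≤ ∣ q - p ∣
p+r≤q⇒r≤∣q-p∣ {p = p} {r = r} {q = q} p+r≤q = begin
  r          ≡⟨ [p+q]-p≡q p r ⟨
  p + r - p  ≤⟨ +-monoˡ-≤ (- p) p+r≤q ⟩
  q - p      ≤⟨ p≤∣p∣ (q - p) ⟩
  ∣ q - p ∣  ∎
  where open ≤-Reasoning

∣p-q∣≤r⇒p≤q+r : ∀ p q → ∣ p - q ∣ ≤ r → p ≤ q + r
∣p-q∣≤r⇒p≤q+r {r} p q ∣p-q∣≤r = begin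
  p            ≡⟨ p≡q+[p-q] p q ⟩
  q + (p - q)  ≤⟨ +-monoʳ-≤ q (≤-trans (p≤∣p∣ (p - q)) ∣p-q∣≤r) ⟩
  q + r        ∎
  where open ≤-Reasoning

∣p-q∣≤r⇒q≤p+r : ∀ p q → ∣ p - q ∣ ≤ r → q ≤ p + r
∣p-q∣≤r⇒q≤p+r p q ∣p-q∣≤r = ∣p-q∣≤r⇒p≤q+r q p (subst (_≤ _) (∣p-q∣≡∣q-p∣ p q) ∣p-q∣≤r)

p≤q+r∧q≤p+r⇒∣p-q∣≤r : ∀ p q → p ≤ q + r → q ≤ p + r → ∣ p - q ∣ ≤ r
p≤q+r∧q≤p+r⇒∣p-q∣≤r {r} p q p≤q+r q≤p+r with ∣p∣≡p∨∣p∣≡-p (p - q)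
... | inj₁ ∣p-q∣≡p-q = subst (_≤ r) (sym ∣p-q∣≡p-q) (p≤q+r⇒p-q≤r p≤q+r)
... | inj₂ ∣p-q∣≡q-p = subst (_≤ r) (sym (trans ∣p-q∣≡q-p (-[p-q]≡q-p p q))) (p≤q+r⇒p-q≤r q≤p+r)

⊔-mono-≤-+ : ∀ q₁ q₂ r → p₁ ≤ q₁ + r → p₂ ≤ q₂ + r → p₁ ⊔ p₂ ≤ (q₁ ⊔ q₂) + r
⊔-mono-≤-+ q₁ q₂ r p₁≤ p₂≤ = ⊔-lub
  (≤-trans p₁≤ (+-monoˡ-≤ r (p≤p⊔q q₁ q₂)))
  (≤-trans p₂≤ (+-monoˡ-≤ r (p≤q⊔p q₁ q₂)))

⊔-nonexpansive : ∀ p₁ p₂ q₁ q₂ →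
  ∣ p₁ - q₁ ∣ ≤ r → ∣ p₂ - q₂ ∣ ≤ r → ∣ (p₁ ⊔ p₂) - (q₁ ⊔ q₂) ∣ ≤ r
⊔-nonexpansive p₁ p₂ q₁ q₂ close₁ close₂ = p≤q+r∧q≤p+r⇒∣p-q∣≤r (p₁ ⊔ p₂) (q₁ ⊔ q₂)
  (⊔-mono-≤-+ q₁ q₂ _ (∣p-q∣≤r⇒p≤q+r p₁ q₁ close₁) (∣p-q∣≤r⇒p≤q+r p₂ q₂ close₂))
  (⊔-mono-≤-+ p₁ p₂ _ (∣p-q∣≤r⇒q≤p+r p₁ q₁ close₁) (∣p-q∣≤r⇒q≤p+r p₂ q₂ close₂))

-- `inK τa τb phat (suc t) i` unfolds to
-- `hysteresis (τm₁ τa τb) (τm₂ τa τb) (inK τa τb phat t i) _`.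
hysteresis : ℚ → ℚ → Bool → ℚ → Bool
hysteresis lo hi on x = if on then (if ⌊ x <? lo ⌋ then false else true) else ⌊ hi ≤? x ⌋

hysteresis-on : lo ≤ hi → ∀ b → hi ≤ x → hysteresis lo hi b x ≡ true
hysteresis-on {lo} {hi} {x} lo≤hi true hi≤x with x <? lo
... | yes x<lo = contradiction (≤-<-trans (≤-trans lo≤hi hi≤x) x<lo) (<-irrefl refl)
... | no _ = refl
hysteresis-on {lo} {hi} {x} lo≤hi false hi≤x with hi ≤? x
... | yes _ = refl
... | no hi≰x = contradiction hi≤x hi≰x

hysteresis-on⇒lo≤ : lo ≤ hi → ∀ b → hysteresis lo hi b x ≡ true → lo ≤ x
hysteresis-on⇒lo≤ {lo} {hi} {x} lo≤hi true on with x <? lo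
... | no x≮lo = ≮⇒≥ x≮lo
hysteresis-on⇒lo≤ {lo} {hi} {x} lo≤hi false on with hi ≤? x
... | yes hi≤x = ≤-trans lo≤hi hi≤x

hysteresis-switch : ∀ b → hysteresis lo hi b x ≢ b → if b then x < lo else hi ≤ x
hysteresis-switch {lo} {hi} {x} true switch with x <? lo
... | yes x<lo = x<lo
... | no _ = contradiction refl switch
hysteresis-switch {lo} {hi} {x} false switch with hi ≤? x
... | yes hi≤x = hi≤x
... | no _ = contradiction refl switch

constant-between : (K : ℕ → A) → s <ℕ t →
  (∀ u → s <ℕ u → u <ℕ t → K (suc u) ≡ K u) → K t ≡ K (suc s)
constant-between {t = suc t} K (s≤s s≤t) steady with m≤n⇒m<n∨m≡n s≤t
... | inj₂ refl = refl
... | inj₁ s<t = trans (steady t s<t ≤ℕ-refl)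
  (constant-between K s<t (λ u s<u u<t → steady u s<u (m<n⇒m<1+n u<t)))

hysteresis-switches-alternate : ∀ {lo hi} (K : ℕ → Bool) (x : ℕ → ℚ) →
  (∀ u → K (suc u) ≡ hysteresis lo hi (K u) (x u)) →
  s <ℕ t → K (suc s) ≢ K s → (∀ u → s <ℕ u → u <ℕ t → K (suc u) ≡ K u) → K (suc t) ≢ K t →
  (hi ≤ x s × x t < lo) ⊎ (x s < lo × hi ≤ x t)
hysteresis-switches-alternate {s = s} {t} K x step s<t switch-s steady switch-t
  with K s | K t
     | hysteresis-switch (K s) (λ e → switch-s (trans (step s) e))
     | hysteresis-switch (K t) (λ e → switch-t (trans (step t) e))
     | trans (constant-between K s<t steady) (¬-not switch-s)
... | false | true  | hi≤xs | xt<lo | _ = inj₁ (hi≤xs , xt<lo)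
... | true  | false | xs<lo | hi≤xt | _ = inj₂ (xs<lo , hi≤xt)
... | false | false | _     | _     | ()
... | true  | true  | _     | _     | ()

hysteresis-on-within : lo ≤ hi → ∀ b x̂ x → ∣ x̂ - x ∣ ≤ ε →
  hi ≤ x - ε → hysteresis lo hi b x̂ ≡ true
hysteresis-on-within lo≤hi b x̂ x close hi≤x-ε =
  hysteresis-on lo≤hi b (≤-trans hi≤x-ε (p≤q+r⇒p-r≤q (∣p-q∣≤r⇒q≤p+r x̂ x close)))

hysteresis-on-within⇒lo-ε≤ : lo ≤ hi → ∀ b x̂ x → ∣ x̂ - x ∣ ≤ ε →
  hysteresis lo hi b x̂ ≡ true → lo - ε ≤ x
hysteresis-on-within⇒lo-ε≤ lo≤hi b x̂ x close on =
  p≤q+r⇒p-r≤q (≤-trans (hysteresis-on⇒lo≤ lo≤hi b on) (∣p-q∣≤r⇒p≤q+r x̂ x close))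

estimates-separated : ∀ x̂ x ŷ y → ∣ x̂ - x ∣ ≤ ε → ∣ ŷ - y ∣ ≤ ε → lo + ε + ε + ε ≤ hi →
  x̂ < lo → hi ≤ ŷ → x + ε < y
estimates-separated {ε} {lo} {hi} x̂ x ŷ y close-x close-y spaced x̂<lo hi≤ŷ = begin-strict
  x + ε                  ≤⟨ +-monoˡ-≤ ε (∣p-q∣≤r⇒q≤p+r x̂ x close-x) ⟩
  x̂ + ε + ε              <⟨ +-monoˡ-< ε (+-monoˡ-< ε x̂<lo) ⟩
  lo + ε + ε             ≡⟨ [p+q]-q≡p (lo + ε + ε) ε ⟨
  lo + ε + ε + ε - ε     ≤⟨ +-monoˡ-≤ (- ε) (≤-trans spaced hi≤ŷ) ⟩
  ŷ - ε                  ≤⟨ p≤q+r⇒p-r≤q (∣p-q∣≤r⇒p≤q+r ŷ y close-y) ⟩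
  y                      ∎
  where open ≤-Reasoning

consecutive-switches-separated : ∀ {lo hi} (K : ℕ → Bool) (x̂ x : ℕ → ℚ) →
  (∀ u → K (suc u) ≡ hysteresis lo hi (K u) (x̂ u)) →
  (∀ u → ∣ x̂ u - x u ∣ ≤ ε) → lo + ε + ε + ε ≤ hi →
  s <ℕ t → K (suc s) ≢ K s → (∀ u → s <ℕ u → u <ℕ t → K (suc u) ≡ K u) → K (suc t) ≢ K t →
  ε ≤ ∣ x t - x s ∣
consecutive-switches-separated {ε} {s} {t} K x̂ x step close spaced
  s<t switch-s steady switch-t
  with hysteresis-switches-alternate K x̂ step s<t switch-s steady switch-t
... | inj₁ (hi≤x̂s , x̂t<lo) = subst (ε ≤_) (∣p-q∣≡∣q-p∣ (x s) (x t))
  (p+r≤q⇒r≤∣q-p∣ (<⇒≤ (estimates-separated (x̂ t) (x t) (x̂ s) (x s)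
    (close t) (close s) spaced x̂t<lo hi≤x̂s)))
... | inj₂ (x̂s<lo , hi≤x̂t) =
  p+r≤q⇒r≤∣q-p∣ (<⇒≤ (estimates-separated (x̂ s) (x s) (x̂ t) (x t)
    (close s) (close t) spaced x̂s<lo hi≤x̂t))

0≤gap : ∀ {τa τb} → τa < τb → 0ℚ ≤ gap τa τb
0≤gap {τa} {τb} τa<τb =
  *-monoʳ-≤-nonNeg fifth (subst (_≤ τb - τa) (+-inverseʳ τa) (+-monoˡ-≤ (- τa) (<⇒≤ τa<τb)))

τm₁+3gap≡τm₂ : ∀ τa τb → τm₁ τa τb + gap τa τb + gap τa τb + gap τa τb ≡ τm₂ τa τb
τm₁+3gap≡τm₂ = solve 2 (λ a b →
  a :+ δ a b :+ δ a b :+ δ a b :+ δ a b := b :- δ a b) refl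
  where δ = λ a b → (b :- a) :* con fifth

τm₁≤τm₂ : ∀ {τa τb} → τa < τb → τm₁ τa τb ≤ τm₂ τa τb
τm₁≤τm₂ {τa} {τb} τa<τb = begin
  τm₁ τa τb                                        ≤⟨ p≤p+q 0≤g ⟩
  τm₁ τa τb + gap τa τb                            ≤⟨ p≤p+q 0≤g ⟩
  τm₁ τa τb + gap τa τb + gap τa τb                ≤⟨ p≤p+q 0≤g ⟩
  τm₁ τa τb + gap τa τb + gap τa τb + gap τa τb    ≡⟨ τm₁+3gap≡τm₂ τa τb ⟩
  τm₂ τa τb                                        ∎
  where
  open ≤-Reasoning
  0≤g : 0ℚ ≤ gap τa τb
  0≤g = 0≤gap τa<τb

lemma3p4 : (τa τb : ℚ) → ½ < τa → τa < τb → τb < 1ℚ →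
    {Q : Set} {n : ℕ} (p : Sign → Q → Fin n → ℚ)
    (v : ℕ → Q) (phat : ℕ → Sign → Fin n → ℚ) →
    (∀ t σ i → ∣ phat t σ i - p σ (v t) i ∣ ≤ gap τa τb) →
    (∀ t i →
      (heavy τb p (v t) i → inK τa τb phat (suc t) i ≡ true)
      × (inK τa τb phat (suc t) i ≡ true → suspect τa p (v t) i))
    × (∀ s t i → s <ℕ t →
      inK τa τb phat (suc s) i ≢ inK τa τb phat s i →
      (∀ u → s <ℕ u → u <ℕ t → inK τa τb phat (suc u) i ≡ inK τa τb phat u i) →
      inK τa τb phat (suc t) i ≢ inK τa τb phat t i →
      gap τa τb ≤ ∣ pmax p (v t) i - pmax p (v s) i ∣)
lemma3p4 τa τb _ τa<τb _ {n = n} p v phat close =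
  (λ t i → heavy⇒reported t i , reported⇒suspect t i)
  , λ s t i → consecutive-switches-separated (reported i) (estimate i) (exact i) (λ _ → refl)
                (estimate-close i) (≤-reflexive (τm₁+3gap≡τm₂ τa τb))
  where
  reported : Fin n → ℕ → Bool
  reported i t = inK τa τb phat t i

  exact : Fin n → ℕ → ℚ
  exact i t = pmax p (v t) i

  estimate : Fin n → ℕ → ℚ
  estimate i t = phat t plus i ⊔ phat t minus i

  estimate-close : ∀ i t → ∣ estimate i t - exact i t ∣ ≤ gap τa τb
  estimate-close i t =
    ⊔-nonexpansive (phat t plus i) (phat t minus i) (p plus (v t) i) (p minus (v t) i)
      (close t plus i) (close t minus i)

  heavy⇒reported : ∀ t i → heavy τb p (v t) i → reported i (suc t) ≡ true
  heavy⇒reported t i τb≤p = hysteresis-on-within (τm₁≤τm₂ τa<τb) (reported i t)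
    (estimate i t) (exact i t) (estimate-close i t) (+-monoˡ-≤ (- gap τa τb) τb≤p)

  reported⇒suspect : ∀ t i → reported i (suc t) ≡ true → suspect τa p (v t) i
  reported⇒suspect t i on = subst (_≤ exact i t) ([p+q]-q≡p τa (gap τa τb))
    (hysteresis-on-within⇒lo-ε≤ (τm₁≤τm₂ τa<τb) (reported i t)
      (estimate i t) (exact i t) (estimate-close i t) on)
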